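{- The inference rule $\frac{\lozenge p\rightarrow q\vee\square(p\rightarrow r)}{\lozenge p\rightarrow q\vee\lozenge r}$ is derivable in $\mathbf{LIK4}$: for all formulas $A,B,C$, if $\lozenge A\rightarrow B\vee\square(A\rightarrow C)\in\mathbf{LIK4}$ then $\lozenge A\rightarrow B\vee\lozenge C\in\mathbf{LIK4}$.
   Context: Let $\mathbf{At}$ be a countably infinite set of atoms. Formulas are given by $A::=p\mid (A\rightarrow A)\mid \top\mid\bot\mid (A\wedge A)\mid (A\vee A)\mid \square A\mid \lozenge A$; $\neg A$ abbreviates $A\rightarrow\bot$. $\mathbf{LIK4}$ is the least set of formulas that is closed under uniform substitution, contains the standard axioms of intuitionistic propositional logic, is closed under the standard inference rules of intuitionistic propositional logic (modus ponens), contains the axioms $\square p\wedge\square q\rightarrow\square(p\wedge q)$, $\lozenge(p\vee q)\rightarrow\lozenge p\vee\lozenge q$, $\square\top$, $\neg\lozenge\bot$, $\square p\rightarrow\square\square p$, $\lozenge\lozenge p\rightarrow\lozenge p$, $\square(p\vee q)\rightarrow\lozenge p\vee\square q$, $\lozenge(p\rightarrow q)\rightarrow(\square p\rightarrow\lozenge q)$, and is closed under the rules: from $p\rightarrow q$ infer $\square p\rightarrow\square q$; from $p\rightarrow q$ infer $\lozenge p\rightarrow\lozenge q$. -}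

module Defs where

open import Data.Nat using (ℕ)

Atom : Set
Atom = ℕ

infixr 5 _⇒_
infixr 6 _∨′_
infixr 7 _∧′_

data Fm : Set where
  var  : Atom → Fm
  _⇒_  : Fm → Fm → Fm
  ⊤′   : Fm
  ⊥′   : Fm
  _∧′_ : Fm → Fm → Fm
  _∨′_ : Fm → Fm → Fm
  □    : Fm → Fm
  ◇    : Fm → Fm

¬′ : Fm → Fm
¬′ A = A ⇒ ⊥′

Subst : Set
Subst = Atom → Fm

sub : Subst → Fm → Fm
sub σ (var x)  = σ x
sub σ (A ⇒ B)  = sub σ A ⇒ sub σ B
sub σ ⊤′       = ⊤′
sub σ ⊥′       = ⊥′
sub σ (A ∧′ B) = sub σ A ∧′ sub σ B
sub σ (A ∨′ B) = sub σ A ∨′ sub σ B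
sub σ (□ A)    = □ (sub σ A)
sub σ (◇ A)    = ◇ (sub σ A)

p q r : Fm
p = var 0
q = var 1
r = var 2

data LIK4 : Fm → Set where
  ax-K     : LIK4 (p ⇒ q ⇒ p)
  ax-S     : LIK4 ((p ⇒ q ⇒ r) ⇒ (p ⇒ q) ⇒ p ⇒ r)
  ax-∧i    : LIK4 (p ⇒ q ⇒ p ∧′ q)
  ax-∧e₁   : LIK4 (p ∧′ q ⇒ p)
  ax-∧e₂   : LIK4 (p ∧′ q ⇒ q)
  ax-∨i₁   : LIK4 (p ⇒ p ∨′ q)
  ax-∨i₂   : LIK4 (q ⇒ p ∨′ q)
  ax-∨e    : LIK4 ((p ⇒ r) ⇒ (q ⇒ r) ⇒ p ∨′ q ⇒ r)
  ax-⊤     : LIK4 ⊤′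
  ax-⊥     : LIK4 (⊥′ ⇒ p)
  ax-□∧    : LIK4 (□ p ∧′ □ q ⇒ □ (p ∧′ q))
  ax-◇∨    : LIK4 (◇ (p ∨′ q) ⇒ ◇ p ∨′ ◇ q)
  ax-□⊤    : LIK4 (□ ⊤′)
  ax-¬◇⊥   : LIK4 (¬′ (◇ ⊥′))
  ax-4□    : LIK4 (□ p ⇒ □ (□ p))
  ax-4◇    : LIK4 (◇ (◇ p) ⇒ ◇ p)
  ax-□∨    : LIK4 (□ (p ∨′ q) ⇒ ◇ p ∨′ □ q)
  ax-◇⇒    : LIK4 (◇ (p ⇒ q) ⇒ (□ p ⇒ ◇ q))
  usub     : ∀ σ {A} → LIK4 A → LIK4 (sub σ A)
  mp       : ∀ {A B} → LIK4 (A ⇒ B) → LIK4 A → LIK4 B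
  mono□    : ∀ {A B} → LIK4 (A ⇒ B) → LIK4 (□ A ⇒ □ B)
  mono◇    : ∀ {A B} → LIK4 (A ⇒ B) → LIK4 (◇ A ⇒ ◇ B)

{-# OPTIONS --safe #-}
module Submission where

open import Defs

-- From ◇A and □(A → C) one gets ◇C: push A → (A → C) → C under ◇ and apply
-- ◇(p → q) → □p → ◇q. Hence, under the hypothesis ◇A, the disjunct □(A → C)
-- may be replaced by ◇C.

[_,_,_] : Fm → Fm → Fm → Subst
[ X , Y , Z ] 0 = X
[ X , Y , Z ] 1 = Y
[ X , Y , Z ] _ = Z

⇒-K : ∀ {X Y} → LIK4 (X ⇒ Y ⇒ X)
⇒-K {X} {Y} = usub [ X , Y , X ] ax-K

⇒-S : ∀ {X Y Z} → LIK4 ((X ⇒ Y ⇒ Z) ⇒ (X ⇒ Y) ⇒ X ⇒ Z)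
⇒-S {X} {Y} {Z} = usub [ X , Y , Z ] ax-S

weaken : ∀ {H Y} → LIK4 Y → LIK4 (H ⇒ Y)
weaken = mp ⇒-K

mp-under : ∀ {H Y Z} → LIK4 (H ⇒ Y ⇒ Z) → LIK4 (H ⇒ Y) → LIK4 (H ⇒ Z)
mp-under f x = mp (mp ⇒-S f) x

⇒-refl : ∀ {X} → LIK4 (X ⇒ X)
⇒-refl {X} = mp-under (⇒-K {Y = X ⇒ X}) ⇒-K

⇒-apply : ∀ {X Y} → LIK4 (X ⇒ (X ⇒ Y) ⇒ Y)
⇒-apply = mp-under (weaken (mp ⇒-S ⇒-refl)) ⇒-K

⇒-compose : ∀ {U V W} → LIK4 ((V ⇒ W) ⇒ (U ⇒ V) ⇒ U ⇒ W)
⇒-compose = mp-under (weaken ⇒-S) ⇒-K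

∘-under : ∀ {H U V W} → LIK4 (H ⇒ V ⇒ W) → LIK4 (H ⇒ U ⇒ V) → LIK4 (H ⇒ U ⇒ W)
∘-under g f = mp-under (mp-under (weaken ⇒-compose) g) f

∨-inj₁ : ∀ {X Y} → LIK4 (X ⇒ X ∨′ Y)
∨-inj₁ {X} {Y} = usub [ X , Y , X ] ax-∨i₁

∨-inj₂ : ∀ {X Y} → LIK4 (Y ⇒ X ∨′ Y)
∨-inj₂ {X} {Y} = usub [ X , Y , X ] ax-∨i₂

∨-elim-under : ∀ {H X Y Z} →
               LIK4 (H ⇒ X ⇒ Z) → LIK4 (H ⇒ Y ⇒ Z) → LIK4 (H ⇒ X ∨′ Y ⇒ Z)
∨-elim-under {X = X} {Y} {Z} f g =
  mp-under (mp-under (weaken (usub [ X , Y , Z ] ax-∨e)) f) g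

∨-mapʳ-under : ∀ {H X Y Y′} → LIK4 (H ⇒ Y ⇒ Y′) → LIK4 (H ⇒ X ∨′ Y ⇒ X ∨′ Y′)
∨-mapʳ-under f = ∨-elim-under (weaken ∨-inj₁) (∘-under (weaken ∨-inj₂) f)

◇-□-mp : ∀ {A C} → LIK4 (◇ A ⇒ □ (A ⇒ C) ⇒ ◇ C)
◇-□-mp {A} {C} =
  mp-under (weaken (usub [ A ⇒ C , C , C ] ax-◇⇒)) (mono◇ ⇒-apply)

lemma15 : ∀ (A B C : Fm) → LIK4 (◇ A ⇒ B ∨′ □ (A ⇒ C)) → LIK4 (◇ A ⇒ B ∨′ ◇ C)
lemma15 A B C h = mp-under (∨-mapʳ-under ◇-□-mp) h
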